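{- Let $p\equiv 1\pmod 8$ be a prime. Suppose there is a primitive root $a$ of $\mathbb{F}_p^*$ such that $a(a^2-a+1)\in(\mathbb{F}_p^*)^4=\{x^4:x\in\mathbb{F}_p^*\}$. Then there exists a $1$-factor $F$ of the complete graph $K_{p+1}$ on vertex set $\mathbb{F}_p\cup\{c\}$ ($c\notin\mathbb{F}_p$ an extra vertex) such that (1) every edge of $F$ joins a residue and a non-residue, where $0$ and the nonzero squares of $\mathbb{F}_p$ count as residues and $c$ and the non-squares of $\mathbb{F}_p^*$ count as non-residues; and (2) the lengths of the edges of $F$ are pairwise distinct, where the length of $\{x,y\}$ with $x,y\in\mathbb{F}_p$ is $\{x-y,y-x\}\subset\mathbb{F}_p^*$ and the length of every edge $\{c,x\}$, $x\in\mathbb{F}_p$, is a symbol $\infty$ distinct from all such sets.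
   Context: $\mathbb{F}_p$ is the field with $p$ elements, $\mathbb{F}_p^*=\mathbb{F}_p\setminus\{0\}$. A $1$-factor is a perfect matching. -}

module Defs where

open import Data.Nat using (ℕ; zero; suc; _+_; _*_; _∸_; _^_; _%_; NonZero)
open import Data.Nat.DivMod using (_mod_)
open import Data.Fin using (Fin; toℕ)
open import Data.Fin.Subset using (Subset; ⁅_⁆; _∪_)
open import Data.Maybe using (Maybe; just; nothing)
open import Data.Product using (Σ; ∃; _×_; _,_)
open import Data.Sum using (_⊎_)
open import Data.Empty using (⊥)
open import Relation.Nullary using (¬_)
open import Relation.Binary.PropositionalEquality using (_≡_; _≢_)

-- Elements of F_p are represented by Fin p (canonical residues 0..p-1).

_⊖_ : {p : ℕ} .{{_ : NonZero p}} → Fin p → Fin p → Fin p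
_⊖_ {p} x y = (toℕ x + (p ∸ toℕ y)) mod p

IsPrimitiveRoot : (p : ℕ) .{{_ : NonZero p}} → Fin p → Set
IsPrimitiveRoot p a =
  (toℕ a ≢ 0) ×
  ((x : Fin p) → toℕ x ≢ 0 → ∃ λ k → (toℕ a ^ k) % p ≡ toℕ x % p)

IsNonzeroFourthPower : (p : ℕ) .{{_ : NonZero p}} → ℕ → Set
IsNonzeroFourthPower p n = Σ (Fin p) λ x → (toℕ x ≢ 0) × ((toℕ x ^ 4) % p ≡ n % p)

-- vertex set of K_{p+1}: F_p ∪ {c}, with c = nothing
Vertex : ℕ → Set
Vertex p = Maybe (Fin p)

-- x ∈ F_p is a square (this includes 0 = 0*0)
IsSquare : (p : ℕ) .{{_ : NonZero p}} → Fin p → Set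
IsSquare p x = Σ (Fin p) λ y → (toℕ y * toℕ y) % p ≡ toℕ x

Residue : (p : ℕ) .{{_ : NonZero p}} → Vertex p → Set
Residue p nothing  = ⊥
Residue p (just x) = IsSquare p x

-- a 1-factor (perfect matching) of the complete graph on Vertex p, encoded
-- as its partner map: a fixed-point-free involution; edges are {v , m v}.
record OneFactor (p : ℕ) : Set where
  field
    partner      : Vertex p → Vertex p
    no-fixpoint  : (v : Vertex p) → partner v ≢ v
    involutive   : (v : Vertex p) → partner (partner v) ≡ v
open OneFactor public

-- length of edge {u , v}: nothing = ∞, just S = the set {x - y , y - x} ⊆ F_p
Length : {p : ℕ} .{{_ : NonZero p}} → Vertex p → Vertex p → Maybe (Subset p)
Length (just x) (just y) = just (⁅ x ⊖ y ⁆ ∪ ⁅ y ⊖ x ⁆)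
Length _        _        = nothing

JoinsResNonRes : (p : ℕ) .{{_ : NonZero p}} → Vertex p → Vertex p → Set
JoinsResNonRes p u v =
  (Residue p u × ¬ Residue p v) ⊎ (¬ Residue p u × Residue p v)

GoodOneFactor : (p : ℕ) .{{_ : NonZero p}} → OneFactor p → Set
GoodOneFactor p F =
  ((v : Vertex p) → JoinsResNonRes p v (partner F v)) ×
  ((u v : Vertex p) → u ≢ v → u ≢ partner F v →
     Length u (partner F u) ≢ Length v (partner F v))

{-# OPTIONS --safe #-}
-- Let p = n + 1 = 8m + 1, h = n / 2 = 4m and a the primitive root, so that a ^ h = -1 and the
-- squares of F_p^* are the even powers of a. Pair 0 with c and, for 0 ≤ q < m,
--   a ^ 4q with a ^ (h+4q+1),  a ^ (4q+1) with a ^ (h+4q+2),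
--   a ^ (4q+2) with a ^ (h+4q+3),  a ^ (4q+3) with a ^ (h+4q).
-- Each pair has one even and one odd exponent, hence joins a residue and a non-residue. Since
-- a ^ h = -1 the differences are ±(1+a) a ^ 4q, ±(1+a) a ^ (4q+1), ±(1+a) a ^ (4q+2) and
-- ±a ^ 4q (1 + a³) = ±(1+a) a ^ 4q w with w = a² - a + 1. The hypothesis a w = a ^ 4ℓ gives
-- w = a ^ (4ℓ - 1), so the last difference is ±(1+a) a ^ (4(q+ℓ) - 1). As ±1 = a ^ 0, a ^ h, a length
-- determines its exponent modulo h = 4m, and 4q, 4q+1, 4q+2, 4(q+ℓ) - 1 are pairwise distinct mod 4m.
module Submission where

open import Defs
open import Data.Nat using (ℕ; _+_; _*_; _∸_; _%_; NonZero)
open import Data.Nat.Primality using (Prime)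
open import Data.Fin using (Fin; toℕ)
open import Data.Product using (Σ; ∃; _×_)
open import Relation.Binary.PropositionalEquality using (_≡_)

open import Data.Nat using (zero; suc; _^_; _/_; _≤_; _<_; z≤n; s≤s; s≤s⁻¹; _≟_; >-nonZero; >-nonZero⁻¹; ≢-nonZero)
open import Data.Nat.Properties hiding (suc-injective)
open import Data.Nat.DivMod
open import Data.Nat.Divisibility using (_∣_; divides; ∣-refl; n∣m*n; m%n≡0⇒n∣m; n∣m⇒m%n≡0)
open import Data.Nat.Primality using (euclidsLemma; ¬prime[1])
open import Data.Nat.Tactic.RingSolver using (solve-∀)
open import Data.Fin using (zero; suc; fromℕ<; punchOut; combine; remQuot)
open import Data.Fin.Patterns using (0F; 1F; 2F; 3F)
open import Data.Fin.Properties
  using (toℕ-injective; toℕ<n; toℕ-fromℕ<; punchIn-punchOut; pigeonhole; injective⇒≤; suc-injective;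
         toℕ-combine; combine-remQuot; remQuot-combine; combine-injectiveˡ; combine-injectiveʳ)
open import Data.Fin.Subset using (Subset; _∈_)
open import Data.Fin.Subset.Properties using (∪-comm; x∈⁅x⁆; x∈⁅y⁆⇒x≡y; x∈p∪q⁻; x∈p∪q⁺)
open import Data.Maybe using (Maybe; just; nothing)
open import Data.Maybe.Properties using (just-injective)
open import Data.Product using (_,_; proj₁; proj₂; uncurry)
open import Data.Product.Algebra using (×-distribʳ-⊎)
open import Data.Product.Function.NonDependent.Propositional using (_×-↔_)
open import Data.Sum using (_⊎_; inj₁; inj₂; [_,_]′; swap; reduce)
open import Data.Sum.Properties using (swap-involutive)
open import Function using (id; _∘_)
open import Function.Bundles using (_↔_; mk↔ₛ′; Inverse)
open import Function.Construct.Composition using (_↔-∘_)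
open import Function.Properties.Inverse using (↔-sym; ↔-refl)
open import Level using (0ℓ)
open import Relation.Binary.Bundles using (Setoid)
open import Relation.Binary.Definitions using (tri<; tri≈; tri>)
open import Relation.Binary.PropositionalEquality using (_≢_; refl; sym; trans; cong; cong₂; subst; module ≡-Reasoning)
import Relation.Binary.Reasoning.Setoid as SetoidReasoning
open import Relation.Nullary using (¬_; Dec; yes; no; contradiction; map′)

module Congruence (d : ℕ) .{{_ : NonZero d}} where

  infix 4 _≈_
  -- A record rather than x % d ≡ y % d, so that x and y can be inferred from a proof.
  record _≈_ (x y : ℕ) : Set where
    constructor mk
    field un : x % d ≡ y % d
  open _≈_ public

  ≈-refl : ∀ {x} → x ≈ x
  ≈-refl = mk refl

  ≈-sym : ∀ {x y} → x ≈ y → y ≈ x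
  ≈-sym (mk e) = mk (sym e)

  ≈-trans : ∀ {x y z} → x ≈ y → y ≈ z → x ≈ z
  ≈-trans (mk e) (mk f) = mk (trans e f)

  ≡⇒≈ : ∀ {x y} → x ≡ y → x ≈ y
  ≡⇒≈ refl = ≈-refl

  _≈?_ : ∀ x y → Dec (x ≈ y)
  x ≈? y = map′ mk un (x % d ≟ y % d)

  ≈-setoid : Setoid 0ℓ 0ℓ
  ≈-setoid = record
    { _≈_ = _≈_
    ; isEquivalence = record { refl = ≈-refl ; sym = ≈-sym ; trans = ≈-trans } }

  module ≈-Reasoning = SetoidReasoning ≈-setoid

  %-≈ : ∀ x → x % d ≈ x
  %-≈ x = mk (m%n%n≡m%n x d)

  0%d≡0 : 0 % d ≡ 0
  0%d≡0 = m*n%n≡0 0 d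

  d≈0 : d ≈ 0
  d≈0 = mk (trans (n%n≡0 d) (sym 0%d≡0))

  +-cong : ∀ {x x′ y y′} → x ≈ x′ → y ≈ y′ → x + y ≈ x′ + y′
  +-cong {x} {x′} {y} {y′} (mk e₁) (mk e₂) = mk (begin
    (x + y) % d                ≡⟨ %-distribˡ-+ x y d ⟩
    (x % d + y % d) % d        ≡⟨ cong₂ (λ u v → (u + v) % d) e₁ e₂ ⟩
    (x′ % d + y′ % d) % d      ≡⟨ %-distribˡ-+ x′ y′ d ⟨
    (x′ + y′) % d              ∎)
    where open ≡-Reasoning

  *-cong : ∀ {x x′ y y′} → x ≈ x′ → y ≈ y′ → x * y ≈ x′ * y′
  *-cong {x} {x′} {y} {y′} (mk e₁) (mk e₂) = mk (begin
    (x * y) % d                ≡⟨ %-distribˡ-* x y d ⟩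
    (x % d * (y % d)) % d      ≡⟨ cong₂ (λ u v → (u * v) % d) e₁ e₂ ⟩
    (x′ % d * (y′ % d)) % d    ≡⟨ %-distribˡ-* x′ y′ d ⟨
    (x′ * y′) % d              ∎)
    where open ≡-Reasoning

  *-congˡ : ∀ x {y y′} → y ≈ y′ → x * y ≈ x * y′
  *-congˡ x = *-cong (≈-refl {x})

  ^-congˡ : ∀ {x y} k → x ≈ y → x ^ k ≈ y ^ k
  ^-congˡ zero    _   = ≈-refl
  ^-congˡ (suc k) x≈y = *-cong x≈y (^-congˡ k x≈y)

  ≈0⇒∣ : ∀ {x} → x ≈ 0 → d ∣ x
  ≈0⇒∣ {x} (mk e) = m%n≡0⇒n∣m x d (trans e 0%d≡0)

  ∣⇒≈0 : ∀ {x} → d ∣ x → x ≈ 0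
  ∣⇒≈0 {x} d∣x = mk (trans (n∣m⇒m%n≡0 x d d∣x) (sym 0%d≡0))

  ≈⇒∣∸ : ∀ {x y} → x ≤ y → x ≈ y → d ∣ y ∸ x
  ≈⇒∣∸ {x} {y} x≤y (mk e) = subst (d ∣_) (sym y∸x≡) (n∣m*n (y / d ∸ x / d))
    where
    open ≡-Reasoning
    y∸x≡ : y ∸ x ≡ (y / d ∸ x / d) * d
    y∸x≡ = begin
      y ∸ x                                         ≡⟨ cong₂ _∸_ (m≡m%n+[m/n]*n y d) (m≡m%n+[m/n]*n x d) ⟩
      (y % d + (y / d) * d) ∸ (x % d + (x / d) * d) ≡⟨ cong (λ r → (y % d + (y / d) * d) ∸ (r + (x / d) * d)) e ⟩
      (y % d + (y / d) * d) ∸ (y % d + (x / d) * d) ≡⟨ [m+n]∸[m+o]≡n∸o (y % d) _ _ ⟩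
      (y / d) * d ∸ (x / d) * d                     ≡⟨ *-distribʳ-∸ d (y / d) (x / d) ⟨
      (y / d ∸ x / d) * d                           ∎

  ∣∸⇒≈ : ∀ {x y} → x ≤ y → d ∣ y ∸ x → x ≈ y
  ∣∸⇒≈ {x} {y} x≤y d∣y∸x = mk (begin
    x % d             ≡⟨ %-remove-+ʳ x d∣y∸x ⟨
    (x + (y ∸ x)) % d ≡⟨ cong (_% d) (m+[n∸m]≡n x≤y) ⟩
    y % d             ∎)
    where open ≡-Reasoning

  ≤-cancel⇒cancel : ∀ (f : ℕ → ℕ) → (∀ {x y} → x ≤ y → f x ≈ f y → x ≈ y) →
                    ∀ {x y} → f x ≈ f y → x ≈ y
  ≤-cancel⇒cancel f ≤-cancel {x} {y} e with ≤-total x y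
  ... | inj₁ x≤y = ≤-cancel x≤y e
  ... | inj₂ y≤x = ≈-sym (≤-cancel y≤x (≈-sym e))

  +-cancelˡ : ∀ z {x y} → z + x ≈ z + y → x ≈ y
  +-cancelˡ z = ≤-cancel⇒cancel (z +_) λ {x} {y} x≤y e →
    ∣∸⇒≈ x≤y (subst (d ∣_) ([m+n]∸[m+o]≡n∸o z y x) (≈⇒∣∸ (+-monoʳ-≤ z x≤y) e))

  module _ (isPrime : Prime d) where

    *-≉0 : ∀ {x y} → ¬ x ≈ 0 → ¬ y ≈ 0 → ¬ x * y ≈ 0
    *-≉0 {x} {y} x≉0 y≉0 xy≈0 with euclidsLemma x y isPrime (≈0⇒∣ xy≈0)
    ... | inj₁ d∣x = x≉0 (∣⇒≈0 d∣x)
    ... | inj₂ d∣y = y≉0 (∣⇒≈0 d∣y)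

    *-cancelˡ : ∀ {z} → ¬ z ≈ 0 → ∀ {x y} → z * x ≈ z * y → x ≈ y
    *-cancelˡ {z} z≉0 = ≤-cancel⇒cancel (z *_) λ {x} {y} x≤y e →
      [ (λ d∣z → contradiction (∣⇒≈0 d∣z) z≉0) , ∣∸⇒≈ x≤y ]′
        (euclidsLemma z (y ∸ x) isPrime
          (subst (d ∣_) (sym (*-distribˡ-∸ z y x)) (≈⇒∣∸ (*-monoʳ-≤ z x≤y) e)))

module _ {p : ℕ} .{{_ : NonZero p}} where

  Length-sym : (x y : Fin p) → Length (just x) (just y) ≡ Length (just y) (just x)
  Length-sym x y = cong just (∪-comm _ _)

  Length-≡ : {x y x′ y′ : Fin p} → Length (just x) (just y) ≡ Length (just x′) (just y′) →
             x ⊖ y ≡ x′ ⊖ y′ ⊎ x ⊖ y ≡ y′ ⊖ x′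
  Length-≡ {x} {y} eq with x∈p∪q⁻ _ _ (subst ((x ⊖ y) ∈_) (just-injective eq) (x∈p∪q⁺ (inj₁ (x∈⁅x⁆ _))))
  ... | inj₁ x-y∈ = inj₁ (x∈⁅y⁆⇒x≡y _ x-y∈)
  ... | inj₂ x-y∈ = inj₂ (x∈⁅y⁆⇒x≡y _ x-y∈)

swap≢ : ∀ {A : Set} (i : A ⊎ A) → swap i ≢ i
swap≢ (inj₁ _) ()
swap≢ (inj₂ _) ()

reduce-≡ : ∀ {A : Set} {i j : A ⊎ A} → reduce i ≡ reduce j → i ≡ j ⊎ i ≡ swap j
reduce-≡ {i = inj₁ _} {inj₁ _} refl = inj₁ refl
reduce-≡ {i = inj₁ _} {inj₂ _} refl = inj₂ refl
reduce-≡ {i = inj₂ _} {inj₁ _} refl = inj₂ refl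
reduce-≡ {i = inj₂ _} {inj₂ _} refl = inj₁ refl

-- The nonzero residues of F_p, p = suc n, are the `suc y` with y : Fin n. A pairing lists them
-- as the ends of pairs pr : P, the square end inj₁ pr and the non-square end inj₂ pr; the vertex
-- c (= nothing) is paired with 0.
module Pairing {n : ℕ} {P : Set} (ends : (P ⊎ P) ↔ Fin n) where
  open Inverse ends

  end : P ⊎ P → Vertex (suc n)
  end i = just (suc (to i))

  pairLength : P → Maybe (Subset (suc n))
  pairLength pr = Length (end (inj₁ pr)) (end (inj₂ pr))

  pairPartner : Vertex (suc n) → Vertex (suc n)
  pairPartner nothing        = just zero
  pairPartner (just zero)    = nothing
  pairPartner (just (suc y)) = end (swap (from y))

  pairPartner-involutive : ∀ v → pairPartner (pairPartner v) ≡ v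
  pairPartner-involutive nothing        = refl
  pairPartner-involutive (just zero)    = refl
  pairPartner-involutive (just (suc y)) = cong (just ∘ suc) (begin
    to (swap (from (to (swap (from y))))) ≡⟨ cong (to ∘ swap) (strictlyInverseʳ _) ⟩
    to (swap (swap (from y)))             ≡⟨ cong to (swap-involutive (from y)) ⟩
    to (from y)                           ≡⟨ strictlyInverseˡ y ⟩
    y                                     ∎)
    where open ≡-Reasoning

  pairPartner-no-fixpoint : ∀ v → pairPartner v ≢ v
  pairPartner-no-fixpoint nothing        ()
  pairPartner-no-fixpoint (just zero)    ()
  pairPartner-no-fixpoint (just (suc y)) eq = swap≢ (from y) (begin
    swap (from y)              ≡⟨ strictlyInverseʳ _ ⟨
    from (to (swap (from y)))  ≡⟨ cong from (suc-injective (just-injective eq)) ⟩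
    from y                     ∎)
    where open ≡-Reasoning

  module _ (square-end : ∀ pr → IsSquare (suc n) (suc (to (inj₁ pr))))
           (nonsquare-end : ∀ pr → ¬ IsSquare (suc n) (suc (to (inj₂ pr))))
           (pairLength-injective : ∀ {pr pr′} → pairLength pr ≡ pairLength pr′ → pr ≡ pr′)
           where

    end-joins : ∀ i → JoinsResNonRes (suc n) (end i) (end (swap i))
    end-joins (inj₁ pr) = inj₁ (square-end pr , nonsquare-end pr)
    end-joins (inj₂ pr) = inj₂ (nonsquare-end pr , square-end pr)

    pairPartner-joins : ∀ v → JoinsResNonRes (suc n) v (pairPartner v)
    pairPartner-joins nothing        = inj₂ (id , zero , refl)
    pairPartner-joins (just zero)    = inj₁ ((zero , refl) , id)
    pairPartner-joins (just (suc y)) =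
      subst (λ x → JoinsResNonRes (suc n) (just (suc x)) (pairPartner (just (suc y))))
            (strictlyInverseˡ y) (end-joins (from y))

    Length-end : ∀ i → Length (end i) (end (swap i)) ≡ pairLength (reduce i)
    Length-end (inj₁ pr) = refl
    Length-end (inj₂ pr) = Length-sym (suc (to (inj₂ pr))) (suc (to (inj₁ pr)))

    Length-pairPartner : ∀ y → Length (just (suc y)) (pairPartner (just (suc y))) ≡ pairLength (reduce (from y))
    Length-pairPartner y =
      trans (cong (λ x → Length (just (suc x)) (end (swap (from y)))) (sym (strictlyInverseˡ y)))
            (Length-end (from y))

    pairPartner-distinct-lengths : ∀ u v → u ≢ v → u ≢ pairPartner v →
                                   Length u (pairPartner u) ≢ Length v (pairPartner v)
    pairPartner-distinct-lengths nothing        nothing         u≢v _    = contradiction refl u≢v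
    pairPartner-distinct-lengths nothing        (just zero)     _   u≢v′ = contradiction refl u≢v′
    pairPartner-distinct-lengths nothing        (just (suc _))  _   _    ()
    pairPartner-distinct-lengths (just zero)    nothing         _   u≢v′ = contradiction refl u≢v′
    pairPartner-distinct-lengths (just zero)    (just zero)     u≢v _    = contradiction refl u≢v
    pairPartner-distinct-lengths (just zero)    (just (suc _))  _   _    ()
    pairPartner-distinct-lengths (just (suc _)) nothing         _   _    ()
    pairPartner-distinct-lengths (just (suc _)) (just zero)     _   _    ()
    pairPartner-distinct-lengths (just (suc y)) (just (suc y′)) u≢v u≢v′ eq
      with reduce-≡ (pairLength-injective (trans (sym (Length-pairPartner y)) (trans eq (Length-pairPartner y′))))
    ... | inj₁ same    = u≢v (cong (just ∘ suc) (begin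
      y             ≡⟨ strictlyInverseˡ y ⟨
      to (from y)   ≡⟨ cong to same ⟩
      to (from y′)  ≡⟨ strictlyInverseˡ y′ ⟩
      y′            ∎))
      where open ≡-Reasoning
    ... | inj₂ paired = u≢v′ (cong (just ∘ suc) (trans (sym (strictlyInverseˡ y)) (cong to paired)))

    pairingOneFactor : Σ (OneFactor (suc n)) (GoodOneFactor (suc n))
    pairingOneFactor =
      record { partner = pairPartner ; no-fixpoint = pairPartner-no-fixpoint ; involutive = pairPartner-involutive }
      , pairPartner-joins , pairPartner-distinct-lengths

module PrimitiveRoot {n : ℕ} .{{_ : NonZero n}} (isPrime : Prime (suc n))
                     (a : Fin (suc n)) (isPrimitive : IsPrimitiveRoot (suc n) a) where

  p : ℕ
  p = suc n

  open Congruence p public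

  A : ℕ
  A = toℕ a

  toℕ-≈⇒≡ : {x y : Fin p} → toℕ x ≈ toℕ y → x ≡ y
  toℕ-≈⇒≡ {x} {y} (mk e) =
    toℕ-injective (trans (sym (m<n⇒m%n≡m (toℕ<n x))) (trans e (m<n⇒m%n≡m (toℕ<n y))))

  toℕ-mod : ∀ x → toℕ (x mod p) ≈ x
  toℕ-mod x = ≈-trans (≡⇒≈ (toℕ-fromℕ< _)) (%-≈ x)

  ^-+ : ∀ i j → A ^ (i + j) ≡ A ^ i * A ^ j
  ^-+ = ^-distribˡ-+-* A

  ^≉0 : ∀ k → ¬ A ^ k ≈ 0
  ^≉0 zero    (mk 1≡0) = contradiction (trans (sym (m<n⇒m%n≡m 1<p)) (trans 1≡0 0%d≡0)) λ ()
    where 1<p : 1 < p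
          1<p = s≤s (>-nonZero⁻¹ n)
  ^≉0 (suc k) = *-≉0 isPrime A≉0 (^≉0 k)
    where A≉0 : ¬ A ≈ 0
          A≉0 A≈0 = proj₁ isPrimitive (cong toℕ (toℕ-≈⇒≡ {a} {zero} A≈0))

  suc≢0 : (y : Fin n) → toℕ (suc y) ≢ 0
  suc≢0 _ ()

  log : (x : Fin p) → toℕ x ≢ 0 → ℕ
  log x x≢0 = proj₁ (proj₂ isPrimitive x x≢0)

  ^-log : ∀ x x≢0 → A ^ log x x≢0 ≈ toℕ x
  ^-log x x≢0 = mk (proj₂ (proj₂ isPrimitive x x≢0))

  log⁺ : Fin n → ℕ
  log⁺ y = log (suc y) (suc≢0 y)

  ^-log⁺ : ∀ y → A ^ log⁺ y ≈ toℕ (suc y)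
  ^-log⁺ y = ^-log (suc y) (suc≢0 y)

  ^-mod : ∀ {d} .{{_ : NonZero d}} → A ^ d ≈ 1 → ∀ k → A ^ k ≈ A ^ (k % d)
  ^-mod {d} A^d≈1 k = begin
    A ^ k                             ≡⟨ cong (A ^_) (trans (m≡m%n+[m/n]*n k d) (cong (k % d +_) (*-comm (k / d) d))) ⟩
    A ^ (k % d + d * (k / d))         ≡⟨ trans (^-+ (k % d) _) (cong (A ^ (k % d) *_) (sym (^-*-assoc A d (k / d)))) ⟩
    A ^ (k % d) * (A ^ d) ^ (k / d)   ≈⟨ *-congˡ (A ^ (k % d)) (^-congˡ (k / d) A^d≈1) ⟩
    A ^ (k % d) * 1 ^ (k / d)         ≡⟨ trans (cong (A ^ (k % d) *_) (^-zeroˡ (k / d))) (*-identityʳ _) ⟩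
    A ^ (k % d)                       ∎
    where open ≈-Reasoning

  -- y ↦ log y mod d is injective on F_p^* when a ^ d = 1.
  order-minimal : ∀ {d} .{{_ : NonZero d}} → A ^ d ≈ 1 → n ≤ d
  order-minimal {d} A^d≈1 = injective⇒≤ {f = λ y → log⁺ y mod d} log⁺-mod-injective
    where
    log⁺-mod-injective : ∀ {y y′} → log⁺ y mod d ≡ log⁺ y′ mod d → y ≡ y′
    log⁺-mod-injective {y} {y′} eq = suc-injective (toℕ-≈⇒≡ (begin
      toℕ (suc y)        ≈⟨ ^-log⁺ y ⟨
      A ^ log⁺ y         ≈⟨ ^-mod A^d≈1 (log⁺ y) ⟩
      A ^ (log⁺ y % d)   ≡⟨ cong (A ^_) (trans (sym (toℕ-fromℕ< (m%n<n (log⁺ y) d)))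
                                   (trans (cong toℕ eq) (toℕ-fromℕ< (m%n<n (log⁺ y′) d)))) ⟩
      A ^ (log⁺ y′ % d)  ≈⟨ ^-mod A^d≈1 (log⁺ y′) ⟨
      A ^ log⁺ y′        ≈⟨ ^-log⁺ y′ ⟩
      toℕ (suc y′)       ∎))
      where open ≈-Reasoning

  ^-∸ : ∀ {i j} → i ≤ j → A ^ i ≈ A ^ j → A ^ (j ∸ i) ≈ 1
  ^-∸ {i} {j} i≤j A^i≈A^j = *-cancelˡ isPrime (^≉0 i) (begin
    A ^ i * A ^ (j ∸ i)  ≡⟨ trans (sym (^-+ i (j ∸ i))) (cong (A ^_) (m+[n∸m]≡n i≤j)) ⟩
    A ^ j                ≈⟨ A^i≈A^j ⟨
    A ^ i                ≡⟨ *-identityʳ (A ^ i) ⟨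
    A ^ i * 1            ∎)
    where open ≈-Reasoning

  zero≢^ : ∀ k → zero ≢ (A ^ k) mod p
  zero≢^ k eq = ^≉0 k (≈-trans (≈-sym (toℕ-mod (A ^ k))) (≡⇒≈ (cong toℕ (sym eq))))

  power : ℕ → Fin n
  power k = punchOut (zero≢^ k)

  toℕ-suc-power : ∀ k → toℕ (suc (power k)) ≈ A ^ k
  toℕ-suc-power k = ≈-trans (≡⇒≈ (cong toℕ (punchIn-punchOut (zero≢^ k)))) (toℕ-mod (A ^ k))

  power-injective : ∀ {i j} → power i ≡ power j → A ^ i ≈ A ^ j
  power-injective {i} {j} eq =
    ≈-trans (≈-sym (toℕ-suc-power i)) (≈-trans (≡⇒≈ (cong (toℕ ∘ suc) eq)) (toℕ-suc-power j))

  -- By pigeonhole two of a ^ 0, …, a ^ n agree; their ratio a ^ d has 0 < d ≤ n, so d = n.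
  ^-order : A ^ n ≈ 1
  ^-order with i , j , i<j , same ← pigeonhole (n<1+n n) (power ∘ toℕ)
    = subst (λ d → A ^ d ≈ 1) (≤-antisym (≤-trans (m∸n≤m (toℕ j) (toℕ i)) (s≤s⁻¹ (toℕ<n j))) n≤d) A^d≈1
    where
    A^d≈1 : A ^ (toℕ j ∸ toℕ i) ≈ 1
    A^d≈1 = ^-∸ (<⇒≤ i<j) (power-injective {toℕ i} {toℕ j} same)
    n≤d : n ≤ toℕ j ∸ toℕ i
    n≤d = order-minimal {{>-nonZero (m<n⇒0<n∸m i<j)}} A^d≈1

  ^-distinct-below-order : ∀ {i j} → i % n < j % n → ¬ A ^ i ≈ A ^ j
  ^-distinct-below-order {i} {j} lt A^i≈A^j = <-irrefl refl (begin-strict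
    n                  ≤⟨ order-minimal {{>-nonZero (m<n⇒0<n∸m lt)}} (^-∸ (<⇒≤ lt)
                            (≈-trans (≈-sym (^-mod ^-order i)) (≈-trans A^i≈A^j (^-mod ^-order j)))) ⟩
    j % n ∸ i % n      ≤⟨ m∸n≤m (j % n) (i % n) ⟩
    j % n              <⟨ m%n<n j n ⟩
    n                  ∎)
    where open ≤-Reasoning

  ^-injective : ∀ {i j} → A ^ i ≈ A ^ j → i % n ≡ j % n
  ^-injective {i} {j} A^i≈A^j with <-cmp (i % n) (j % n)
  ... | tri< i%n<j%n _ _ = contradiction A^i≈A^j (^-distinct-below-order i%n<j%n)
  ... | tri≈ _ i%n≡j%n _ = i%n≡j%n
  ... | tri> _ _ j%n<i%n = contradiction (≈-sym A^i≈A^j) (^-distinct-below-order j%n<i%n)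

  -- k ↦ a ^ k, with k < n and with F_p^* encoded as Fin n via suc.
  powers : Fin n ↔ Fin n
  powers = mk↔ₛ′ (power ∘ toℕ) (λ y → log⁺ y mod n) power-log⁺ log⁺-power
    where
    power-log⁺ : ∀ y → power (toℕ (log⁺ y mod n)) ≡ y
    power-log⁺ y = suc-injective (toℕ-≈⇒≡ (begin
      toℕ (suc (power (toℕ (log⁺ y mod n))))  ≈⟨ toℕ-suc-power (toℕ (log⁺ y mod n)) ⟩
      A ^ toℕ (log⁺ y mod n)                  ≡⟨ cong (A ^_) (toℕ-fromℕ< (m%n<n (log⁺ y) n)) ⟩
      A ^ (log⁺ y % n)                        ≈⟨ ^-mod ^-order (log⁺ y) ⟨
      A ^ log⁺ y                              ≈⟨ ^-log⁺ y ⟩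
      toℕ (suc y)                             ∎))
      where open ≈-Reasoning

    log⁺-power : ∀ k → log⁺ (power (toℕ k)) mod n ≡ k
    log⁺-power k = toℕ-injective (begin
      toℕ (log⁺ (power (toℕ k)) mod n)  ≡⟨ toℕ-fromℕ< (m%n<n (log⁺ (power (toℕ k))) n) ⟩
      log⁺ (power (toℕ k)) % n          ≡⟨ ^-injective (≈-trans (^-log⁺ (power (toℕ k))) (toℕ-suc-power (toℕ k))) ⟩
      toℕ k % n                         ≡⟨ m<n⇒m%n≡m (toℕ<n k) ⟩
      toℕ k                             ∎)
      where open ≡-Reasoning

  square-of-even : ∀ {x : Fin p} k → toℕ x ≈ A ^ k → k % 2 ≡ 0 → IsSquare p x
  square-of-even {x} k x≈A^k k%2≡0 = r , (begin
    (toℕ r * toℕ r) % p              ≡⟨ un (*-cong (toℕ-mod (A ^ (k / 2))) (toℕ-mod (A ^ (k / 2)))) ⟩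
    (A ^ (k / 2) * A ^ (k / 2)) % p  ≡⟨ cong (_% p) (trans (sym (^-+ (k / 2) (k / 2))) (cong (A ^_) k/2+k/2≡k)) ⟩
    A ^ k % p                        ≡⟨ un x≈A^k ⟨
    toℕ x % p                        ≡⟨ m<n⇒m%n≡m (toℕ<n x) ⟩
    toℕ x                            ∎)
    where
    open ≡-Reasoning
    r = (A ^ (k / 2)) mod p
    k/2+k/2≡k : k / 2 + k / 2 ≡ k
    k/2+k/2≡k = sym (begin
      k                    ≡⟨ m≡m%n+[m/n]*n k 2 ⟩
      k % 2 + (k / 2) * 2  ≡⟨ cong (_+ (k / 2) * 2) k%2≡0 ⟩
      (k / 2) * 2          ≡⟨ double (k / 2) ⟩
      k / 2 + k / 2        ∎)
      where double : ∀ u → u * 2 ≡ u + u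
            double = solve-∀

  module Half {h : ℕ} (n≡h+h : n ≡ h + h) where

    h≢0 : h ≢ 0
    h≢0 refl = <-irrefl (sym n≡h+h) (>-nonZero⁻¹ n)

    h<n : h < n
    h<n = subst (h <_) (sym n≡h+h) (m<m+n h (n≢0⇒n>0 h≢0))

    h∣n : h ∣ n
    h∣n = divides 2 (trans n≡h+h (cong (h +_) (sym (+-identityʳ h))))

    2∣n : 2 ∣ n
    2∣n = divides h (trans n≡h+h (trans (cong (h +_) (sym (+-identityʳ h))) (*-comm 2 h)))

    instance
      h-nonZero : NonZero h
      h-nonZero = ≢-nonZero h≢0

    %n⇒%h : ∀ {i j} → i % n ≡ j % n → i % h ≡ j % h
    %n⇒%h {i} {j} e =
      trans (sym (m∣n⇒o%n%m≡o%m h n i h∣n)) (trans (cong (_% h) e) (m∣n⇒o%n%m≡o%m h n j h∣n))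

    ^h²≈1 : A ^ h * A ^ h ≈ 1
    ^h²≈1 = ≈-trans (≡⇒≈ (trans (sym (^-+ h h)) (cong (A ^_) (sym n≡h+h)))) ^-order

    -- (a ^ h + 1) · a ^ h = (a ^ h + 1) · 1, while a ^ h ≠ 1 because 0 < h < n.
    ^-half : A ^ h + 1 ≈ 0
    ^-half with (A ^ h + 1) ≈? 0
    ... | yes A^h+1≈0 = A^h+1≈0
    ... | no  A^h+1≉0 = contradiction h≡0 h≢0
      where
      y : ℕ
      y = A ^ h
      y≈1 : y ≈ 1
      y≈1 = *-cancelˡ isPrime A^h+1≉0 (begin
        (y + 1) * y    ≡⟨ trans (*-distribʳ-+ y y 1) (cong (y * y +_) (*-identityˡ y)) ⟩
        y * y + y      ≈⟨ +-cong ^h²≈1 ≈-refl ⟩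
        1 + y          ≡⟨ trans (+-comm 1 y) (sym (*-identityʳ (y + 1))) ⟩
        (y + 1) * 1    ∎)
        where open ≈-Reasoning
      h≡0 : h ≡ 0
      h≡0 = trans (sym (m<n⇒m%n≡m h<n)) (trans (^-injective {h} {0} y≈1) (m<n⇒m%n≡m (>-nonZero⁻¹ n)))

    1+A≉0 : h ≢ 1 → ¬ 1 + A ≈ 0
    1+A≉0 h≢1 1+A≈0 = h≢1 (sym (trans (sym (m<n⇒m%n≡m 1<n)) (trans (^-injective {1} {h} A≈A^h) (m<n⇒m%n≡m h<n))))
      where
      1<n : 1 < n
      1<n = ≤-<-trans (n≢0⇒n>0 h≢0) h<n
      A≈A^h : A ^ 1 ≈ A ^ h
      A≈A^h = +-cancelˡ 1 (≈-trans (≡⇒≈ (cong suc (*-identityʳ A))) (≈-trans 1+A≈0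
                (≈-trans (≈-sym ^-half) (≡⇒≈ (+-comm (A ^ h) 1)))))

    ⊖-≈ : ∀ (x y : Fin p) → toℕ (x ⊖ y) ≈ toℕ x + A ^ h * toℕ y
    ⊖-≈ x y = ≈-trans (toℕ-mod _) (+-cong (≈-refl {toℕ x}) (+-cancelˡ (toℕ y) (begin
      toℕ y + (p ∸ toℕ y)       ≡⟨ m+[n∸m]≡n (<⇒≤ (toℕ<n y)) ⟩
      p                         ≈⟨ d≈0 ⟩
      0 * toℕ y                 ≈⟨ *-cong ^-half ≈-refl ⟨
      (A ^ h + 1) * toℕ y       ≡⟨ distrib (A ^ h) (toℕ y) ⟩
      toℕ y + A ^ h * toℕ y     ∎)))
      where open ≈-Reasoning
            distrib : ∀ u v → (u + 1) * v ≡ v + u * v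
            distrib = solve-∀

    ⊖-swap : ∀ (x y : Fin p) → toℕ (y ⊖ x) ≈ A ^ h * toℕ (x ⊖ y)
    ⊖-swap x y = begin
      toℕ (y ⊖ x)                             ≈⟨ ⊖-≈ y x ⟩
      toℕ y + A ^ h * toℕ x                   ≡⟨ +-comm (toℕ y) _ ⟩
      A ^ h * toℕ x + toℕ y                   ≈⟨ +-cong (≈-refl {A ^ h * toℕ x}) (≈-trans (*-cong ^h²≈1 (≈-refl {toℕ y})) (≡⇒≈ (*-identityˡ (toℕ y)))) ⟨
      A ^ h * toℕ x + A ^ h * A ^ h * toℕ y   ≡⟨ distrib (A ^ h) (toℕ x) (toℕ y) ⟩
      A ^ h * (toℕ x + A ^ h * toℕ y)         ≈⟨ *-congˡ (A ^ h) (⊖-≈ x y) ⟨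
      A ^ h * toℕ (x ⊖ y)                     ∎
      where open ≈-Reasoning
            distrib : ∀ u v w → u * v + u * u * w ≡ u * (v + u * w)
            distrib = solve-∀

    nonsquare-of-odd : ∀ {x : Fin p} k → toℕ x ≈ A ^ k → k % 2 ≡ 1 → ¬ IsSquare p x
    nonsquare-of-odd {x} k x≈A^k k%2≡1 (w , w²≡x) with toℕ w ≟ 0
    ... | yes w≡0 = ^≉0 k (begin
      A ^ k              ≈⟨ x≈A^k ⟨
      toℕ x              ≈⟨ x≈w² ⟩
      toℕ w * toℕ w      ≡⟨ cong (λ u → u * u) w≡0 ⟩
      0                  ∎)
      where open ≈-Reasoning
            x≈w² : toℕ x ≈ toℕ w * toℕ w
            x≈w² = ≈-trans (≈-sym (≡⇒≈ w²≡x)) (%-≈ _)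
    ... | no  w≢0 = contradiction (begin
      0                  ≡⟨ m*n%n≡0 ℓ 2 ⟨
      ℓ * 2 % 2          ≡⟨ cong (_% 2) (*-comm ℓ 2) ⟩
      (ℓ + (ℓ + 0)) % 2  ≡⟨ cong (λ u → (ℓ + u) % 2) (+-identityʳ ℓ) ⟩
      (ℓ + ℓ) % 2        ≡⟨ m∣n⇒o%n%m≡o%m 2 n (ℓ + ℓ) 2∣n ⟨
      (ℓ + ℓ) % n % 2    ≡⟨ cong (_% 2) (^-injective A^[ℓ+ℓ]≈A^k) ⟩
      k % n % 2          ≡⟨ m∣n⇒o%n%m≡o%m 2 n k 2∣n ⟩
      k % 2              ≡⟨ k%2≡1 ⟩
      1                  ∎) λ ()
      where
      open ≡-Reasoning
      ℓ = log w w≢0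
      A^[ℓ+ℓ]≈A^k : A ^ (ℓ + ℓ) ≈ A ^ k
      A^[ℓ+ℓ]≈A^k = ≈-trans (≡⇒≈ (^-+ ℓ ℓ)) (≈-trans (*-cong (^-log w w≢0) (^-log w w≢0))
                      (≈-trans (≈-sym (%-≈ (toℕ w * toℕ w))) (≈-trans (≡⇒≈ w²≡x) x≈A^k)))

    Length-≡⇒exponents : ∀ {c L L′} {x y x′ y′ : Fin p} → ¬ c ≈ 0 →
      toℕ (x ⊖ y) ≈ c * A ^ L → toℕ (x′ ⊖ y′) ≈ c * A ^ L′ →
      Length (just x) (just y) ≡ Length (just x′) (just y′) → L % h ≡ L′ % h
    Length-≡⇒exponents {c} {L} {L′} {x} {y} {x′} {y′} c≉0 x-y≈ x′-y′≈ same
      with Length-≡ {x = x} {y} {x′} {y′} same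
    ... | inj₁ eq = %n⇒%h (^-injective (*-cancelˡ isPrime c≉0 (begin
      c * A ^ L            ≈⟨ x-y≈ ⟨
      toℕ (x ⊖ y)          ≡⟨ cong toℕ eq ⟩
      toℕ (x′ ⊖ y′)        ≈⟨ x′-y′≈ ⟩
      c * A ^ L′           ∎)))
      where open ≈-Reasoning
    ... | inj₂ eq = trans (%n⇒%h (^-injective (*-cancelˡ isPrime c≉0 (begin
      c * A ^ L            ≈⟨ x-y≈ ⟨
      toℕ (x ⊖ y)          ≡⟨ cong toℕ eq ⟩
      toℕ (y′ ⊖ x′)        ≈⟨ ⊖-swap x′ y′ ⟩
      A ^ h * toℕ (x′ ⊖ y′) ≈⟨ *-congˡ (A ^ h) x′-y′≈ ⟩
      A ^ h * (c * A ^ L′)  ≡⟨ rearrange (A ^ h) c (A ^ L′) ⟩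
      c * (A ^ h * A ^ L′)  ≡⟨ cong (c *_) (^-+ h L′) ⟨
      c * A ^ (h + L′)     ∎)))) (%-remove-+ˡ L′ (∣-refl {h}))
      where open ≈-Reasoning
            rearrange : ∀ u v w → u * (v * w) ≡ v * (u * w)
            rearrange = solve-∀

-- Writing n = p - 1 as 2 * m * 4 makes Fin n the codomain of
-- `combine`: an exponent k < n is k = 4 (m b + q) + r with slot (b , r) and block q < m. In block q,
-- class c pairs the exponents in squareSlot c and nonsquareSlot c, i.e. 4q with h+4q+1,
-- h+4q+2 with 4q+1, 4q+2 with h+4q+3, and h+4q with 4q+3.
module Construction (m₀ : ℕ) where

  m h n : ℕ
  m = suc m₀
  h = m * 4
  n = 2 * m * 4

  n≡h+h : n ≡ h + h
  n≡h+h = double m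
    where double : ∀ m → 2 * m * 4 ≡ m * 4 + m * 4
          double = solve-∀

  Slot : Set
  Slot = Fin 2 × Fin 4

  squareSlot nonsquareSlot : Fin 4 → Slot
  squareSlot 0F = 0F , 0F
  squareSlot 1F = 1F , 2F
  squareSlot 2F = 0F , 2F
  squareSlot 3F = 1F , 0F
  nonsquareSlot 0F = 1F , 1F
  nonsquareSlot 1F = 0F , 1F
  nonsquareSlot 2F = 1F , 3F
  nonsquareSlot 3F = 0F , 3F

  slotEnd : Slot → Fin 4 ⊎ Fin 4
  slotEnd (0F , 0F) = inj₁ 0F
  slotEnd (0F , 1F) = inj₂ 1F
  slotEnd (0F , 2F) = inj₁ 2F
  slotEnd (0F , 3F) = inj₂ 3F
  slotEnd (1F , 0F) = inj₁ 3F
  slotEnd (1F , 1F) = inj₂ 0F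
  slotEnd (1F , 2F) = inj₁ 1F
  slotEnd (1F , 3F) = inj₂ 2F

  slots : (Fin 4 ⊎ Fin 4) ↔ Slot
  slots = mk↔ₛ′ [ squareSlot , nonsquareSlot ]′ slotEnd slot-slotEnd slotEnd-slot
    where
    slot-slotEnd : ∀ s → [ squareSlot , nonsquareSlot ]′ (slotEnd s) ≡ s
    slot-slotEnd (0F , 0F) = refl
    slot-slotEnd (0F , 1F) = refl
    slot-slotEnd (0F , 2F) = refl
    slot-slotEnd (0F , 3F) = refl
    slot-slotEnd (1F , 0F) = refl
    slot-slotEnd (1F , 1F) = refl
    slot-slotEnd (1F , 2F) = refl
    slot-slotEnd (1F , 3F) = refl
    slotEnd-slot : ∀ e → slotEnd ([ squareSlot , nonsquareSlot ]′ e) ≡ e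
    slotEnd-slot (inj₁ 0F) = refl
    slotEnd-slot (inj₁ 1F) = refl
    slotEnd-slot (inj₁ 2F) = refl
    slotEnd-slot (inj₁ 3F) = refl
    slotEnd-slot (inj₂ 0F) = refl
    slotEnd-slot (inj₂ 1F) = refl
    slotEnd-slot (inj₂ 2F) = refl
    slotEnd-slot (inj₂ 3F) = refl

  exponents : (Slot × Fin m) ↔ Fin n
  exponents = mk↔ₛ′ exponent (slotOf ∘ remQuot 4) exponent-slotOf slotOf-exponent
    where
    exponent : Slot × Fin m → Fin n
    exponent ((b , r) , q) = combine (combine b q) r
    slotOf : Fin (2 * m) × Fin 4 → Slot × Fin m
    slotOf (i , r) = let (b , q) = remQuot m i in (b , r) , q
    exponent-slotOf : ∀ k → exponent (slotOf (remQuot 4 k)) ≡ k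
    exponent-slotOf k = trans (combine-slotOf (remQuot 4 k)) (combine-remQuot {2 * m} 4 k)
      where combine-slotOf : ∀ ir → exponent (slotOf ir) ≡ uncurry combine ir
            combine-slotOf (i , r) = cong (λ i′ → combine i′ r) (combine-remQuot {2} m i)
    slotOf-exponent : ∀ e → slotOf (remQuot 4 (exponent e)) ≡ e
    slotOf-exponent ((b , r) , q) =
      trans (cong slotOf (remQuot-combine (combine b q) r))
            (cong (λ (b′ , q′) → ((b′ , r) , q′)) (remQuot-combine b q))

  Pair : Set
  Pair = Fin 4 × Fin m

  ends : (Pair ⊎ Pair) ↔ Fin n
  ends = exponents ↔-∘ ((slots ×-↔ ↔-refl) ↔-∘ ↔-sym (×-distribʳ-⊎ _ (Fin m) (Fin 4) (Fin 4)))

  h+[1*h+k]≡h+h+k : ∀ h k → h + (1 * h + k) ≡ h + h + k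
  h+[1*h+k]≡h+h+k = solve-∀

  offset : Slot → ℕ
  offset (b , r) = toℕ b * h + toℕ r

  toℕ-exponents : ∀ s q → toℕ (Inverse.to exponents (s , q)) ≡ offset s + toℕ q * 4
  toℕ-exponents (b , r) q = begin
    toℕ (combine (combine b q) r)     ≡⟨ toℕ-combine (combine b q) r ⟩
    4 * toℕ (combine b q) + toℕ r     ≡⟨ cong (λ i → 4 * i + toℕ r) (toℕ-combine b q) ⟩
    4 * (m * toℕ b + toℕ q) + toℕ r   ≡⟨ rearrange m (toℕ b) (toℕ q) (toℕ r) ⟩
    offset (b , r) + toℕ q * 4        ∎
    where open ≡-Reasoning
          rearrange : ∀ m b q r → 4 * (m * b + q) + r ≡ (b * (m * 4) + r) + q * 4
          rearrange = solve-∀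

  exponent-parity : ∀ s q → (offset s + q * 4) % 2 ≡ toℕ (proj₂ s) % 2
  exponent-parity (b , r) q = trans (cong (_% 2) (rearrange m (toℕ b) (toℕ r) q))
                                    ([m+kn]%n≡m%n (toℕ r) (toℕ b * m * 2 + q * 2) 2)
    where rearrange : ∀ m b r q → b * (m * 4) + r + q * 4 ≡ r + (b * m * 2 + q * 2) * 2
          rearrange = solve-∀

  block-mod-h : ∀ e Z (r : Fin 4) → (e * h + (Z * 4 + toℕ r)) % h ≡ toℕ (combine (Z mod m) r)
  block-mod-h e Z r = begin
    (e * h + (Z * 4 + toℕ r)) % h   ≡⟨ cong (_% h) (+-comm (e * h) _) ⟩
    (Z * 4 + toℕ r + e * h) % h     ≡⟨ [m+kn]%n≡m%n (Z * 4 + toℕ r) e h ⟩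
    (Z * 4 + toℕ r) % (m * 4)       ≡⟨ [m*n+o]%[p*n]≡[m*n]%[p*n]+o Z m (toℕ<n r) ⟩
    (Z * 4) % (m * 4) + toℕ r       ≡⟨ cong (_+ toℕ r) (m%n*o≡m*o%[n*o] Z m 4) ⟨
    (Z % m) * 4 + toℕ r             ≡⟨ cong (_+ toℕ r) (trans (*-comm (Z % m) 4) (cong (4 *_) (sym (toℕ-fromℕ< (m%n<n Z m))))) ⟩
    4 * toℕ (Z mod m) + toℕ r       ≡⟨ toℕ-combine (Z mod m) r ⟨
    toℕ (combine (Z mod m) r)       ∎
    where open ≡-Reasoning

  shift : ℕ → Fin m → Fin m
  shift σ q = (σ + toℕ q) mod m

  shift-injective : ∀ σ {q q′ : Fin m} → shift σ q ≡ shift σ q′ → q ≡ q′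
  shift-injective σ {q} {q′} eq = toℕ-injective (begin
    toℕ q       ≡⟨ m<n⇒m%n≡m (toℕ<n q) ⟨
    toℕ q % m   ≡⟨ M.un (M.+-cancelˡ σ (M.mk (begin
                     (σ + toℕ q) % m           ≡⟨ toℕ-fromℕ< (m%n<n (σ + toℕ q) m) ⟨
                     toℕ ((σ + toℕ q) mod m)   ≡⟨ cong toℕ eq ⟩
                     toℕ ((σ + toℕ q′) mod m)  ≡⟨ toℕ-fromℕ< (m%n<n (σ + toℕ q′) m) ⟩
                     (σ + toℕ q′) % m          ∎))) ⟩
    toℕ q′ % m  ≡⟨ m<n⇒m%n≡m (toℕ<n q′) ⟩
    toℕ q′      ∎)
    where open ≡-Reasoning
          module M = Congruence m

  module _ (isPrime : Prime (suc n)) (a : Fin (suc n)) (isPrimitive : IsPrimitiveRoot (suc n) a)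
           (fourthPower : IsNonzeroFourthPower (suc n) (toℕ a * (toℕ a * toℕ a + 1 ∸ toℕ a))) where

    open PrimitiveRoot isPrime a isPrimitive
    open Half {h} n≡h+h

    w : ℕ
    w = A * A + 1 ∸ A

    -- With the fourth root x = a ^ ℓ: a w = a ^ 4ℓ, so w = a ^ (n - 1 + 4ℓ), and n - 1 + 4ℓ = 3 + 4s.
    ℓ s logw : ℕ
    ℓ = log (proj₁ fourthPower) (proj₁ (proj₂ fourthPower))
    s = m₀ + m + ℓ
    logw = 3 + s * 4

    ^-logw : A ^ logw ≈ w
    ^-logw = *-cancelˡ isPrime (^≉0 1) (begin
      A ^ 1 * A ^ logw                ≡⟨ ^-+ 1 logw ⟨
      A ^ (1 + logw)                  ≡⟨ cong (A ^_) (exponent m₀ ℓ) ⟩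
      A ^ (n + ℓ * 4)                 ≡⟨ ^-+ n (ℓ * 4) ⟩
      A ^ n * A ^ (ℓ * 4)             ≈⟨ *-cong ^-order ≈-refl ⟩
      1 * A ^ (ℓ * 4)                 ≡⟨ trans (*-identityˡ _) (sym (^-*-assoc A ℓ 4)) ⟩
      (A ^ ℓ) ^ 4                     ≈⟨ ^-congˡ 4 (^-log (proj₁ fourthPower) (proj₁ (proj₂ fourthPower))) ⟩
      toℕ (proj₁ fourthPower) ^ 4     ≈⟨ mk (proj₂ (proj₂ fourthPower)) ⟩
      A * w                           ≡⟨ cong (_* w) (*-identityʳ A) ⟨
      A ^ 1 * w                       ∎)
      where
      open ≈-Reasoning
      exponent : ∀ m₀ ℓ → 1 + (3 + (m₀ + suc m₀ + ℓ) * 4) ≡ 2 * suc m₀ * 4 + ℓ * 4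
      exponent = solve-∀

    cube-sum : (1 + A) * A ^ logw ≈ 1 + A ^ 3
    cube-sum = ≈-trans (*-congˡ (1 + A) ^-logw) (≡⇒≈ (+-cancelʳ-≡ ((1 + A) * A) _ _ (begin
      (1 + A) * w + (1 + A) * A        ≡⟨ *-distribˡ-+ (1 + A) w A ⟨
      (1 + A) * (w + A)                ≡⟨ cong ((1 + A) *_) (m∸n+n≡m A≤A*A+1) ⟩
      (1 + A) * (A * A + 1)            ≡⟨ expand A ⟩
      1 + A ^ 3 + (1 + A) * A          ∎)))
      where
      open ≡-Reasoning
      A≤A*A+1 : A ≤ A * A + 1
      A≤A*A+1 with A
      ... | zero  = z≤n
      ... | suc b = ≤-trans (m≤m*n (suc b) (suc b)) (m≤m+n _ 1)
      expand : ∀ a → (1 + a) * (a * a + 1) ≡ 1 + a * (a * (a * 1)) + (1 + a) * a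
      expand = solve-∀

    consecutive : ∀ k → A ^ k + A ^ (k + 1) ≡ (1 + A) * A ^ k
    consecutive k = trans (cong (A ^ k +_) (^-+ k 1)) (factor (A ^ k) A)
      where factor : ∀ x a → x + x * (a * 1) ≡ (1 + a) * x
            factor = solve-∀

    ^-period : ∀ k → A ^ (h + h + k) ≈ A ^ k
    ^-period k = ≈-trans (≡⇒≈ (trans (^-+ (h + h) k) (cong (_* A ^ k) (^-+ h h))))
                         (≈-trans (*-cong ^h²≈1 ≈-refl) (≡⇒≈ (*-identityˡ (A ^ k))))

    -- The two ends of class c in block q differ by (1 + a) a ^ (μ c + 4q).
    μ : Fin 4 → ℕ
    μ 0F = 0
    μ 1F = h + 1
    μ 2F = 2
    μ 3F = h + logw

    pair-sum : ∀ c → A ^ offset (squareSlot c) + A ^ (h + offset (nonsquareSlot c)) ≈ (1 + A) * A ^ μ c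
    pair-sum 0F = begin
      A ^ 0 + A ^ (h + (1 * h + 1))   ≡⟨ cong (λ k → A ^ 0 + A ^ k) (h+[1*h+k]≡h+h+k h 1) ⟩
      A ^ 0 + A ^ (h + h + 1)         ≈⟨ +-cong ≈-refl (^-period 1) ⟩
      A ^ 0 + A ^ 1                   ≡⟨ consecutive 0 ⟩
      (1 + A) * A ^ 0                 ∎
      where open ≈-Reasoning
    pair-sum 1F = ≡⇒≈ (begin
      A ^ (1 * h + 2) + A ^ (h + 1)   ≡⟨ +-comm (A ^ (1 * h + 2)) _ ⟩
      A ^ (h + 1) + A ^ (1 * h + 2)   ≡⟨ cong (λ k → A ^ (h + 1) + A ^ k) (rearrange h) ⟩
      A ^ (h + 1) + A ^ (h + 1 + 1)   ≡⟨ consecutive (h + 1) ⟩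
      (1 + A) * A ^ (h + 1)           ∎)
      where open ≡-Reasoning
            rearrange : ∀ h → 1 * h + 2 ≡ h + 1 + 1
            rearrange = solve-∀
    pair-sum 2F = begin
      A ^ 2 + A ^ (h + (1 * h + 3))   ≡⟨ cong (λ k → A ^ 2 + A ^ k) (h+[1*h+k]≡h+h+k h 3) ⟩
      A ^ 2 + A ^ (h + h + 3)         ≈⟨ +-cong ≈-refl (^-period 3) ⟩
      A ^ 2 + A ^ (2 + 1)             ≡⟨ consecutive 2 ⟩
      (1 + A) * A ^ 2                 ∎
      where open ≈-Reasoning
    pair-sum 3F = begin
      A ^ (1 * h + 0) + A ^ (h + 3)   ≡⟨ cong₂ _+_ (cong (A ^_) (simplify h)) (^-+ h 3) ⟩
      A ^ h + A ^ h * A ^ 3           ≡⟨ factor (A ^ h) (A ^ 3) ⟩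
      A ^ h * (1 + A ^ 3)             ≈⟨ *-congˡ (A ^ h) cube-sum ⟨
      A ^ h * ((1 + A) * A ^ logw)    ≡⟨ rearrange (A ^ h) (1 + A) (A ^ logw) ⟩
      (1 + A) * (A ^ h * A ^ logw)    ≡⟨ cong ((1 + A) *_) (^-+ h logw) ⟨
      (1 + A) * A ^ (h + logw)        ∎
      where open ≈-Reasoning
            simplify : ∀ h → 1 * h + 0 ≡ h
            simplify = solve-∀
            factor : ∀ x y → x + x * y ≡ x * (1 + y)
            factor = solve-∀
            rearrange : ∀ x y z → x * (y * z) ≡ y * (x * z)
            rearrange = solve-∀

    pairing : (Pair ⊎ Pair) ↔ Fin n
    pairing = powers ↔-∘ ends

    open Inverse pairing using (to)

    squareEnd nonsquareEnd : Fin 4 → Fin m → Fin (suc n)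
    squareEnd    c q = suc (to (inj₁ (c , q)))
    nonsquareEnd c q = suc (to (inj₂ (c , q)))

    toℕ-squareEnd : ∀ c q → toℕ (squareEnd c q) ≈ A ^ (offset (squareSlot c) + toℕ q * 4)
    toℕ-squareEnd c q = ≈-trans (toℕ-suc-power (toℕ (Inverse.to exponents (squareSlot c , q))))
                                (≡⇒≈ (cong (A ^_) (toℕ-exponents (squareSlot c) q)))

    toℕ-nonsquareEnd : ∀ c q → toℕ (nonsquareEnd c q) ≈ A ^ (offset (nonsquareSlot c) + toℕ q * 4)
    toℕ-nonsquareEnd c q = ≈-trans (toℕ-suc-power (toℕ (Inverse.to exponents (nonsquareSlot c , q))))
                                   (≡⇒≈ (cong (A ^_) (toℕ-exponents (nonsquareSlot c) q)))

    square-end : ∀ pr → IsSquare (suc n) (suc (to (inj₁ pr)))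
    square-end (c , q) = square-of-even (offset (squareSlot c) + toℕ q * 4) (toℕ-squareEnd c q)
      (trans (exponent-parity (squareSlot c) (toℕ q)) (even c))
      where even : ∀ c → toℕ (proj₂ (squareSlot c)) % 2 ≡ 0
            even 0F = refl
            even 1F = refl
            even 2F = refl
            even 3F = refl

    nonsquare-end : ∀ pr → ¬ IsSquare (suc n) (suc (to (inj₂ pr)))
    nonsquare-end (c , q) = nonsquare-of-odd (offset (nonsquareSlot c) + toℕ q * 4) (toℕ-nonsquareEnd c q)
      (trans (exponent-parity (nonsquareSlot c) (toℕ q)) (odd c))
      where odd : ∀ c → toℕ (proj₂ (nonsquareSlot c)) % 2 ≡ 1
            odd 0F = refl
            odd 1F = refl
            odd 2F = refl
            odd 3F = refl

    end-difference : ∀ c q → toℕ (squareEnd c q ⊖ nonsquareEnd c q) ≈ (1 + A) * A ^ (μ c + toℕ q * 4)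
    end-difference c q = begin
      toℕ (x ⊖ y)                                  ≈⟨ ⊖-≈ x y ⟩
      toℕ x + A ^ h * toℕ y                        ≈⟨ +-cong (toℕ-squareEnd c q) (*-congˡ (A ^ h) (toℕ-nonsquareEnd c q)) ⟩
      A ^ (o₀ + Q) + A ^ h * A ^ (o₁ + Q)          ≡⟨ cong₂ (λ u v → u + A ^ h * v) (^-+ o₀ Q) (^-+ o₁ Q) ⟩
      A ^ o₀ * A ^ Q + A ^ h * (A ^ o₁ * A ^ Q)    ≡⟨ factor (A ^ o₀) (A ^ h) (A ^ o₁) (A ^ Q) ⟩
      (A ^ o₀ + A ^ h * A ^ o₁) * A ^ Q            ≡⟨ cong (λ u → (A ^ o₀ + u) * A ^ Q) (^-+ h o₁) ⟨
      (A ^ o₀ + A ^ (h + o₁)) * A ^ Q              ≈⟨ *-cong (pair-sum c) ≈-refl ⟩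
      (1 + A) * A ^ μ c * A ^ Q                    ≡⟨ *-assoc (1 + A) (A ^ μ c) (A ^ Q) ⟩
      (1 + A) * (A ^ μ c * A ^ Q)                  ≡⟨ cong ((1 + A) *_) (^-+ (μ c) Q) ⟨
      (1 + A) * A ^ (μ c + Q)                      ∎
      where
      open ≈-Reasoning
      x = squareEnd c q
      y = nonsquareEnd c q
      o₀ = offset (squareSlot c)
      o₁ = offset (nonsquareSlot c)
      Q = toℕ q * 4
      factor : ∀ u v w z → u * z + v * (w * z) ≡ (u + v * w) * z
      factor = solve-∀

    ε σ : Fin 4 → ℕ
    ε 0F = 0
    ε 1F = 1
    ε 2F = 0
    ε 3F = 1
    σ 0F = 0
    σ 1F = 0
    σ 2F = 0
    σ 3F = s

    μ-form : ∀ c Q → μ c + Q * 4 ≡ ε c * h + ((σ c + Q) * 4 + toℕ c)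
    μ-form 0F Q = sym (+-identityʳ (Q * 4))
    μ-form 1F Q = form₁ h Q
      where form₁ : ∀ h Q → h + 1 + Q * 4 ≡ 1 * h + (Q * 4 + 1)
            form₁ = solve-∀
    μ-form 2F Q = +-comm 2 (Q * 4)
    μ-form 3F Q = form₃ h s Q
      where form₃ : ∀ h s Q → h + (3 + s * 4) + Q * 4 ≡ 1 * h + ((s + Q) * 4 + 3)
            form₃ = solve-∀

    length-exponent-mod-h : ∀ c q → (μ c + toℕ q * 4) % h ≡ toℕ (combine (shift (σ c) q) c)
    length-exponent-mod-h c q =
      trans (cong (_% h) (μ-form c (toℕ q))) (block-mod-h (ε c) (σ c + toℕ q) c)

    open Pairing pairing using (pairLength; pairingOneFactor)

    pairLength-≡⇒blocks-≡ : ∀ {c q c′ q′} → pairLength (c , q) ≡ pairLength (c′ , q′) →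
                            combine (shift (σ c) q) c ≡ combine (shift (σ c′) q′) c′
    pairLength-≡⇒blocks-≡ {c} {q} {c′} {q′} same = toℕ-injective (begin
      toℕ (combine (shift (σ c) q) c)     ≡⟨ length-exponent-mod-h c q ⟨
      (μ c + toℕ q * 4) % h               ≡⟨ exponents-≡ ⟩
      (μ c′ + toℕ q′ * 4) % h             ≡⟨ length-exponent-mod-h c′ q′ ⟩
      toℕ (combine (shift (σ c′) q′) c′)  ∎)
      where
      open ≡-Reasoning
      exponents-≡ : (μ c + toℕ q * 4) % h ≡ (μ c′ + toℕ q′ * 4) % h
      exponents-≡ = Length-≡⇒exponents {L = μ c + toℕ q * 4} {μ c′ + toℕ q′ * 4}
                      {squareEnd c q} {nonsquareEnd c q} {squareEnd c′ q′} {nonsquareEnd c′ q′}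
                      (1+A≉0 λ ()) (end-difference c q) (end-difference c′ q′) same

    pairLength-injective : ∀ {pr pr′} → pairLength pr ≡ pairLength pr′ → pr ≡ pr′
    pairLength-injective {c , q} {c′ , q′} same = cong₂ _,_ c≡c′ (shift-injective (σ c) shifts≡)
      where
      blocks≡ : combine (shift (σ c) q) c ≡ combine (shift (σ c′) q′) c′
      blocks≡ = pairLength-≡⇒blocks-≡ {c} {q} {c′} {q′} same
      c≡c′ : c ≡ c′
      c≡c′ = combine-injectiveʳ (shift (σ c) q) c (shift (σ c′) q′) c′ blocks≡
      shifts≡ : shift (σ c) q ≡ shift (σ c) q′
      shifts≡ = subst (λ c″ → shift (σ c) q ≡ shift (σ c″) q′) (sym c≡c′)
                      (combine-injectiveˡ (shift (σ c) q) c (shift (σ c′) q′) c′ blocks≡)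

    goodOneFactor : Σ (OneFactor (suc n)) (GoodOneFactor (suc n))
    goodOneFactor = pairingOneFactor square-end nonsquare-end pairLength-injective

prime≡1[mod8]⇒p≡1+8m : ∀ p → Prime p → p % 8 ≡ 1 → ∃ λ m₀ → p ≡ suc (2 * suc m₀ * 4)
prime≡1[mod8]⇒p≡1+8m p isPrime p%8≡1 with p / 8 | trans (m≡m%n+[m/n]*n p 8) (cong (_+ (p / 8) * 8) p%8≡1)
... | 0      | p≡1 = contradiction (subst Prime p≡1 isPrime) ¬prime[1]
... | suc m₀ | p≡  = m₀ , trans p≡ (form m₀)
  where form : ∀ m₀ → 1 + suc m₀ * 8 ≡ suc (2 * suc m₀ * 4)
        form = solve-∀

proposition2p1 : (p : ℕ) .{{_ : NonZero p}} → Prime p → p % 8 ≡ 1 →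
    (a : Fin p) → IsPrimitiveRoot p a →
    IsNonzeroFourthPower p (toℕ a * (toℕ a * toℕ a + 1 ∸ toℕ a)) →
    Σ (OneFactor p) λ F → GoodOneFactor p F
proposition2p1 p isPrime p%8≡1 a isPrimitive fourthPower
  with m₀ , refl ← prime≡1[mod8]⇒p≡1+8m p isPrime p%8≡1
  = Construction.goodOneFactor m₀ isPrime a isPrimitive fourthPower
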